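{- Let $A,B$ be justification formulas and $w$ a first-sort justification term. If $\mathsf{J}^+\vdash B\to[w](A\wedge B)$, then there exists a second-sort justification term $t(x_0)$ containing no variables other than $x_0$ such that $\mathsf{J}^+\vdash B\to[t(w)]_{\mathsf{tc}}A$, where $t(w)$ is the result of substituting $w$ for $x_0$. Moreover, if $B\to[w](A\wedge B)$ has an injective proof in $\mathsf{J}^+$, then $B\to[t(w)]_{\mathsf{tc}}A$ has an injective proof in $\mathsf{J}^+$.
   Context: Justification terms of two sorts are built simultaneously from first-sort variables $x_0,x_1,\dots$, second-sort variables $y_0,y_1,\dots$ and second-sort constants $c_0,c_1,\dots$: first-sort $w::=x_i\mid(w\cdot w)\mid\mathsf{head}(s)\mid\mathsf{tail}(s)\mid(w+w)$; second-sort $s::=y_i\mid c_i\mid(s\cdot s)\mid\mathsf{ind}(w,s)\mid(s+s)$. Formulas: $A::=p_i\mid\bot\mid(A\to A)\mid[w]A\mid[s]_{\mathsf{tc}}A$; $\neg A:=A\to\bot$, $A\wedge B:=\neg(A\to\neg B)$, $A\vee B:=\neg A\to B$. $\mathsf{J}^+_0$ has the rule modus ponens and axioms (for all formulas $A,B,C$, first-sort $h,w$, second-sort $t,s$): (i) $A\to(B\to A)$; (ii) $(A\to(B\to C))\to((A\to B)\to(A\to C))$; (iii) $\neg\neg A\to A$; (iv) $[h](A\to B)\to([w]A\to[h\cdot w]B)$; (v) $[h]A\vee[w]A\to[h+w]A$; (vi) $[t]_{\mathsf{tc}}(A\to B)\to([s]_{\mathsf{tc}}A\to[t\cdot s]_{\mathsf{tc}}B)$;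 (vii) $[s]_{\mathsf{tc}}A\to[\mathsf{head}(s)]A$; (viii) $[s]_{\mathsf{tc}}A\to[\mathsf{tail}(s)][s]_{\mathsf{tc}}A$; (ix) $[w]A\wedge[s]_{\mathsf{tc}}(A\to[w]A)\to[\mathsf{ind}(w,s)]_{\mathsf{tc}}A$; (x) $[t]_{\mathsf{tc}}A\vee[s]_{\mathsf{tc}}A\to[t+s]_{\mathsf{tc}}A$. $\mathsf{J}^+$ is $\mathsf{J}^+_0$ plus all formulas $[c]_{\mathsf{tc}}A$ ($c$ a constant, $A$ an axiom of $\mathsf{J}^+_0$) as additional axioms. For a proof $\pi$ in $\mathsf{J}^+$, $\mathit{cs}(\pi)$ is the set of axioms of the form $[c]_{\mathsf{tc}}A$ occurring in $\pi$; $\pi$ is injective if $[c]_{\mathsf{tc}}A,[c]_{\mathsf{tc}}B\in\mathit{cs}(\pi)$ implies $A=B$. -}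

module Defs where

open import Data.Nat using (ℕ; zero; suc)
open import Data.Product using (_×_; _,_)
open import Data.List using (List; []; _∷_; _++_)
open import Data.List.Membership.Propositional using (_∈_)
open import Relation.Binary.PropositionalEquality using (_≡_)
open import Data.Empty using (⊥)
open import Data.Unit using (⊤)

mutual
  data Tm₁ : Set where
    x    : ℕ → Tm₁
    _·₁_ : Tm₁ → Tm₁ → Tm₁
    head : Tm₂ → Tm₁
    tail : Tm₂ → Tm₁
    _+₁_ : Tm₁ → Tm₁ → Tm₁

  data Tm₂ : Set where
    y    : ℕ → Tm₂
    c    : ℕ → Tm₂
    _·₂_ : Tm₂ → Tm₂ → Tm₂
    ind  : Tm₁ → Tm₂ → Tm₂
    _+₂_ : Tm₂ → Tm₂ → Tm₂

infixr 5 _⇒_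
infix 8 [_]_ [_]tc_
infixr 6 _∧'_ _∨'_
infix 7 ¬'_
data Fm : Set where
  p      : ℕ → Fm
  ⊥'     : Fm
  _⇒_    : Fm → Fm → Fm
  [_]_   : Tm₁ → Fm → Fm
  [_]tc_ : Tm₂ → Fm → Fm

¬'_ : Fm → Fm
¬' A = A ⇒ ⊥'

_∧'_ : Fm → Fm → Fm
A ∧' B = ¬' (A ⇒ ¬' B)

_∨'_ : Fm → Fm → Fm
A ∨' B = (¬' A) ⇒ B

data Ax₀ : Fm → Set where
  ax-i    : ∀ A B → Ax₀ (A ⇒ (B ⇒ A))
  ax-ii   : ∀ A B C → Ax₀ ((A ⇒ (B ⇒ C)) ⇒ ((A ⇒ B) ⇒ (A ⇒ C)))
  ax-iii  : ∀ A → Ax₀ (¬' ¬' A ⇒ A)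
  ax-iv   : ∀ A B h w → Ax₀ ([ h ] (A ⇒ B) ⇒ ([ w ] A ⇒ [ h ·₁ w ] B))
  ax-v    : ∀ A h w → Ax₀ (([ h ] A ∨' [ w ] A) ⇒ [ h +₁ w ] A)
  ax-vi   : ∀ A B t s → Ax₀ ([ t ]tc (A ⇒ B) ⇒ ([ s ]tc A ⇒ [ t ·₂ s ]tc B))
  ax-vii  : ∀ A s → Ax₀ ([ s ]tc A ⇒ [ head s ] A)
  ax-viii : ∀ A s → Ax₀ ([ s ]tc A ⇒ [ tail s ] ([ s ]tc A))
  ax-ix   : ∀ A w s → Ax₀ (([ w ] A ∧' [ s ]tc (A ⇒ [ w ] A)) ⇒ [ ind w s ]tc A)
  ax-x    : ∀ A t s → Ax₀ (([ t ]tc A ∨' [ s ]tc A) ⇒ [ t +₂ s ]tc A)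

-- Proofs in J⁺ (as derivation trees), with axioms [c_i]_tc A for A an
-- axiom of J⁺₀.

data Prf : Fm → Set where
  ax  : ∀ {A} → Ax₀ A → Prf A
  cax : ∀ {A} (i : ℕ) → Ax₀ A → Prf ([ c i ]tc A)
  mp  : ∀ {A B} → Prf (A ⇒ B) → Prf A → Prf B

cs : ∀ {F} → Prf F → List (ℕ × Fm)
cs (ax _)           = []
cs (cax {A} i _)    = (i , A) ∷ []
cs (mp π₁ π₂)       = cs π₁ ++ cs π₂

Injective : ∀ {F} → Prf F → Set
Injective π = ∀ i A B → (i , A) ∈ cs π → (i , B) ∈ cs π → A ≡ B

mutual
  OnlyX0₁ : Tm₁ → Set
  OnlyX0₁ (x zero)    = ⊤
  OnlyX0₁ (x (suc _)) = ⊥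
  OnlyX0₁ (u ·₁ v)    = OnlyX0₁ u × OnlyX0₁ v
  OnlyX0₁ (head s)    = OnlyX0₂ s
  OnlyX0₁ (tail s)    = OnlyX0₂ s
  OnlyX0₁ (u +₁ v)    = OnlyX0₁ u × OnlyX0₁ v

  OnlyX0₂ : Tm₂ → Set
  OnlyX0₂ (y _)       = ⊥
  OnlyX0₂ (c _)       = ⊤
  OnlyX0₂ (s ·₂ t)    = OnlyX0₂ s × OnlyX0₂ t
  OnlyX0₂ (ind u s)   = OnlyX0₁ u × OnlyX0₂ s
  OnlyX0₂ (s +₂ t)    = OnlyX0₂ s × OnlyX0₂ t

mutual
  sub₁ : Tm₁ → Tm₁ → Tm₁
  sub₁ w (x zero)    = w
  sub₁ w (x (suc i)) = x (suc i)
  sub₁ w (u ·₁ v)    = sub₁ w u ·₁ sub₁ w v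
  sub₁ w (head s)    = head (sub₂ w s)
  sub₁ w (tail s)    = tail (sub₂ w s)
  sub₁ w (u +₁ v)    = sub₁ w u +₁ sub₁ w v

  sub₂ : Tm₁ → Tm₂ → Tm₂
  sub₂ w (y i)       = y i
  sub₂ w (c i)       = c i
  sub₂ w (s ·₂ t)    = sub₂ w s ·₂ sub₂ w t
  sub₂ w (ind u s)   = ind (sub₁ w u) (sub₂ w s)
  sub₂ w (s +₂ t)    = sub₂ w s +₂ sub₂ w t

{-# OPTIONS --safe #-}
module Submission where

-- Since A ∧ B implies B, the hypothesis yields ⊢ A ∧ B → [w](A ∧ B).
-- By the lifting lemma every theorem F of J⁺ is justified, [s]_tc F, by a closed
-- term s built from constants; lifting this implication gives s, and axiom (ix)
-- turns B into [ind(w, s)]_tc (A ∧ B).  Lifting A ∧ B → A to [k]_tc (A ∧ B → A)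
-- and applying axiom (vi) gives B → [k · ind(w, s)]_tc A, so t(x₀) = k · ind(x₀, s).
-- Lifting spends a new constant at every leaf of the proof, always one not yet
-- used, so it preserves injectivity.

open import Defs
open import Data.Product using (Σ; _×_; _,_; proj₁)
open import Data.Nat using (ℕ; suc; _<_; s≤s)
open import Data.Nat.Properties using (<-irrefl; m<n⇒m<1+n; n<1+n)
open import Data.List using (List; []; _∷_; _++_; map)
open import Data.List.Properties using (++-assoc; ++-identityʳ)
open import Data.List.Extrema.Nat using (max; xs≤max)
open import Data.List.Membership.Propositional using (_∈_)
open import Data.List.Membership.Propositional.Properties using (∈-map⁺)
open import Data.List.Relation.Unary.All using (lookup)
open import Data.List.Relation.Unary.Any using (here; there)
open import Data.List.Relation.Binary.Subset.Propositional using (_⊆_)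
open import Data.List.Relation.Binary.Subset.Propositional.Properties
  using (⊆-refl; ⊆-trans; ⊆-reflexive; ⊆-reflexive-↭; ∈-∷⁺ʳ; xs⊆xs++ys; xs⊆ys++xs; ++⁺ʳ)
open import Data.List.Relation.Binary.Permutation.Propositional.Properties using (++-comm)
open import Data.Unit using (tt)
open import Data.Empty using (⊥-elim)
open import Relation.Binary.PropositionalEquality using (_≡_; refl; sym; cong₂; subst)

private
  variable
    A B C F G K : Fm
    Γ : List Fm
    l m : List (ℕ × Fm)
    n : ℕ
    w : Tm₁
    s k : Tm₂

infix 3 _⊢_
infixl 5 _∙_

data _⊢_ (Γ : List Fm) : Fm → Set where
  hyp   : A ∈ Γ → Γ ⊢ A
  axiom : Ax₀ A → Γ ⊢ A
  _∙_   : Γ ⊢ A ⇒ B → Γ ⊢ A → Γ ⊢ B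

hyp₀ : A ∷ Γ ⊢ A
hyp₀ = hyp (here refl)

hyp₁ : B ∷ A ∷ Γ ⊢ A
hyp₁ = hyp (there (here refl))

hyp₂ : C ∷ B ∷ A ∷ Γ ⊢ A
hyp₂ = hyp (there (there (here refl)))

⇒-refl : Γ ⊢ A ⇒ A
⇒-refl {A = A} = axiom (ax-ii A (A ⇒ A) A) ∙ axiom (ax-i A (A ⇒ A)) ∙ axiom (ax-i A A)

deduction : A ∷ Γ ⊢ B → Γ ⊢ A ⇒ B
deduction (hyp (here refl))       = ⇒-refl
deduction {A = A} (hyp (there i)) = axiom (ax-i _ A) ∙ hyp i
deduction {A = A} (axiom a)       = axiom (ax-i _ A) ∙ axiom a
deduction {A = A} (d ∙ e)         = axiom (ax-ii A _ _) ∙ deduction d ∙ deduction e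

⊢⇒Prf : [] ⊢ A → Prf A
⊢⇒Prf (axiom a) = ax a
⊢⇒Prf (d ∙ e)   = mp (⊢⇒Prf d) (⊢⇒Prf e)

∧-intro : Prf (A ⇒ B ⇒ A ∧' B)
∧-intro = ⊢⇒Prf (deduction (deduction (deduction (hyp₀ ∙ hyp₂ ∙ hyp₁))))

∧-elimˡ : Prf (A ∧' B ⇒ A)
∧-elimˡ {A = A} = ⊢⇒Prf (deduction (axiom (ax-iii A) ∙ deduction (hyp₁ ∙ deduction (deduction (hyp₂ ∙ hyp₁)))))

∧-elimʳ : Prf (A ∧' B ⇒ B)
∧-elimʳ {A = A} {B = B} = ⊢⇒Prf (deduction (axiom (ax-iii B) ∙ deduction (hyp₁ ∙ (axiom (ax-i (¬' B) A) ∙ hyp₀))))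

weaken : Prf G → Prf (F ⇒ G)
weaken {G = G} {F = F} π = mp (ax (ax-i G F)) π

mp-under : Prf (F ⇒ G ⇒ K) → Prf (F ⇒ G) → Prf (F ⇒ K)
mp-under {F = F} {G = G} {K = K} π ρ = mp (mp (ax (ax-ii F G K)) π) ρ

InjectiveCS : List (ℕ × Fm) → Set
InjectiveCS l = ∀ i A B → (i , A) ∈ l → (i , B) ∈ l → A ≡ B

IndicesBelow : ℕ → List (ℕ × Fm) → Set
IndicesBelow n l = ∀ {i A} → (i , A) ∈ l → i < n

InjectiveBelow : ℕ → List (ℕ × Fm) → Set
InjectiveBelow n l = InjectiveCS l × IndicesBelow n l

injectiveBelow-⊆ : m ⊆ l → InjectiveBelow n l → InjectiveBelow n m
injectiveBelow-⊆ m⊆l (inj , below) = (λ i A B a b → inj i A B (m⊆l a) (m⊆l b)) , λ a → below (m⊆l a)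

injectiveBelow-fresh : InjectiveBelow n l → InjectiveBelow (suc n) ((n , A) ∷ l)
injectiveBelow-fresh {n = n} {l = l} {A = A} (inj , below) = inj′ , below′
  where
  below′ : IndicesBelow (suc n) ((n , A) ∷ l)
  below′ (here refl) = n<1+n n
  below′ (there a)   = m<n⇒m<1+n (below a)

  inj′ : InjectiveCS ((n , A) ∷ l)
  inj′ i B C (here refl) (here refl) = refl
  inj′ i B C (here refl) (there b)   = ⊥-elim (<-irrefl refl (below b))
  inj′ i B C (there a)   (here refl) = ⊥-elim (<-irrefl refl (below a))
  inj′ i B C (there a)   (there b)   = inj i B C a b

freshIndex : List (ℕ × Fm) → ℕ
freshIndex l = suc (max 0 (map proj₁ l))

indicesBelow-freshIndex : IndicesBelow (freshIndex l) l
indicesBelow-freshIndex {l = l} a = s≤s (lookup (xs≤max 0 (map proj₁ l)) (∈-map⁺ proj₁ a))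

Injective-subst : (e : F ≡ G) {π : Prf F} → Injective π → Injective (subst Prf e π)
Injective-subst refl inj = inj

nextIndex : ℕ → Prf F → ℕ
nextIndex n (ax _)    = suc n
nextIndex n (cax _ _) = suc n
nextIndex n (mp π ρ)  = nextIndex (nextIndex n ρ) π

liftTerm : ℕ → Prf F → Tm₂
liftTerm n (ax _)    = c n
liftTerm n (cax i _) = ind (tail (c i)) (c n)
liftTerm n (mp π ρ)  = liftTerm (nextIndex n ρ) π ·₂ liftTerm n ρ

-- For an axiom [cᵢ]_tc G, axiom (viii) gives [tail cᵢ][cᵢ]_tc G, the new constant
-- cₙ justifies that instance of (viii), and (ix) combines the two.
lift : (n : ℕ) (π : Prf F) → Prf ([ liftTerm n π ]tc F)
lift n (ax a) = cax n a
lift n (cax {G} i a) =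
  mp (ax (ax-ix ([ c i ]tc G) (tail (c i)) (c n)))
     (mp (mp ∧-intro (mp (ax (ax-viii G (c i))) (cax i a))) (cax n (ax-viii G (c i))))
lift n (mp {A} {B} π ρ) = mp (mp (ax (ax-vi A B _ _)) (lift (nextIndex n ρ) π)) (lift n ρ)

liftTerm-onlyX0 : (n : ℕ) (π : Prf F) → OnlyX0₂ (liftTerm n π)
liftTerm-onlyX0 n (ax _)    = tt
liftTerm-onlyX0 n (cax _ _) = tt , tt
liftTerm-onlyX0 n (mp π ρ)  = liftTerm-onlyX0 (nextIndex n ρ) π , liftTerm-onlyX0 n ρ

sub₂-liftTerm : (w : Tm₁) (π : Prf F) → sub₂ w (liftTerm n π) ≡ liftTerm n π
sub₂-liftTerm w (ax _)    = refl
sub₂-liftTerm w (cax _ _) = refl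
sub₂-liftTerm w (mp π ρ)  = cong₂ _·₂_ (sub₂-liftTerm w π) (sub₂-liftTerm w ρ)

lift-injectiveBelow : (π : Prf F) → cs π ⊆ l → InjectiveBelow n l →
                      InjectiveBelow (nextIndex n π) (cs (lift n π) ++ l)
lift-injectiveBelow (ax _) _ inv = injectiveBelow-fresh inv
lift-injectiveBelow (cax _ _) cs⊆l inv =
  injectiveBelow-⊆ (∈-∷⁺ʳ (there (cs⊆l (here refl))) ⊆-refl) (injectiveBelow-fresh inv)
lift-injectiveBelow {l = l} {n = n} (mp π ρ) cs⊆l inv =
  injectiveBelow-⊆ (⊆-reflexive (++-assoc (cs (lift (nextIndex n ρ) π)) (cs (lift n ρ)) l)) invπ
  where
  invρ : InjectiveBelow (nextIndex n ρ) (cs (lift n ρ) ++ l)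
  invρ = lift-injectiveBelow ρ (⊆-trans (xs⊆ys++xs (cs ρ) (cs π)) cs⊆l) inv
  invπ : InjectiveBelow (nextIndex n (mp π ρ)) (cs (lift (nextIndex n ρ) π) ++ (cs (lift n ρ) ++ l))
  invπ = lift-injectiveBelow π
           (⊆-trans (xs⊆xs++ys (cs π) (cs ρ)) (⊆-trans cs⊆l (xs⊆ys++xs l (cs (lift n ρ))))) invρ

induction-under : Prf (F ⇒ [ w ] G) → Prf ([ s ]tc (G ⇒ [ w ] G)) → Prf (F ⇒ [ ind w s ]tc G)
induction-under {w = w} {G = G} {s = s} π σ =
  mp-under (weaken (ax (ax-ix G w s))) (mp-under (mp-under (weaken ∧-intro) π) (weaken σ))

app-under : Prf ([ k ]tc (G ⇒ K)) → Prf (F ⇒ [ s ]tc G) → Prf (F ⇒ [ k ·₂ s ]tc K)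
app-under {k = k} {G = G} {K = K} {s = s} κ π = mp-under (weaken (mp (ax (ax-vi G K k s)) κ)) π

mainTheorem8 : (A B : Fm) (w : Tm₁) (π : Prf (B ⇒ [ w ] (A ∧' B)))
    → Σ Tm₂ (λ t → OnlyX0₂ t × Σ (Prf (B ⇒ [ sub₂ w t ]tc A)) (λ π' → Injective π → Injective π'))
mainTheorem8 A B w π =
  t , (liftTerm-onlyX0 n₁ τ , tt , liftTerm-onlyX0 n₀ ρ) ,
  subst Prf t[w] π′ , λ inj → Injective-subst t[w] (injective inj)
  where
  ρ : Prf (A ∧' B ⇒ [ w ] (A ∧' B))
  ρ = mp-under (weaken π) ∧-elimʳ
  τ : Prf (A ∧' B ⇒ A)
  τ = ∧-elimˡ
  n₀ n₁ : ℕ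
  n₀ = freshIndex (cs π)
  n₁ = nextIndex n₀ ρ
  t : Tm₂
  t = liftTerm n₁ τ ·₂ ind (x 0) (liftTerm n₀ ρ)
  π′ : Prf (B ⇒ [ liftTerm n₁ τ ·₂ ind w (liftTerm n₀ ρ) ]tc A)
  π′ = app-under (lift n₁ τ) (induction-under π (lift n₀ ρ))
  t[w] : (B ⇒ [ liftTerm n₁ τ ·₂ ind w (liftTerm n₀ ρ) ]tc A) ≡ (B ⇒ [ sub₂ w t ]tc A)
  t[w] = sym (cong₂ (λ k s → B ⇒ [ k ·₂ ind w s ]tc A) (sub₂-liftTerm w τ) (sub₂-liftTerm w ρ))
  injective : Injective π → Injective π′
  injective inj = proj₁ (injectiveBelow-⊆ reorder inv₂)
    where
    inv₁ : InjectiveBelow n₁ (cs (lift n₀ ρ) ++ cs π)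
    inv₁ = lift-injectiveBelow ρ (⊆-reflexive (++-identityʳ (cs π))) (inj , indicesBelow-freshIndex)
    inv₂ : InjectiveBelow (nextIndex n₁ τ) (cs (lift n₁ τ) ++ (cs (lift n₀ ρ) ++ cs π))
    inv₂ = lift-injectiveBelow τ (λ ()) inv₁
    reorder : cs π′ ⊆ cs (lift n₁ τ) ++ (cs (lift n₀ ρ) ++ cs π)
    reorder = ++⁺ʳ (cs (lift n₁ τ)) (⊆-reflexive-↭ (++-comm (cs π) (cs (lift n₀ ρ))))
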